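{- Let $G$ be a reduced graph and let $H$ be an induced subgraph of $G$ which is nonsingular and satisfies $r(H)=r(G)$. Assume that $G$ has exactly two vertices $u,v$ not in $H$. Let $\tilde G$ be the graph obtained from $G$ by adding the edge $uv$ if $uv\notin E(G)$, or by deleting the edge $uv$ if $uv\in E(G)$. Then $r(\tilde G)=r(G)+2$.
   Context: All graphs are finite and simple. The rank $r(G)$ of a graph $G$ is the rank of its adjacency matrix; $G$ is nonsingular if its adjacency matrix is invertible. A graph is reduced if distinct vertices have distinct neighborhoods. -}

module Defs where

open import Data.Nat using (ℕ; zero; suc)
open import Data.Fin using (Fin; zero; suc; _≟_)
open import Data.Bool using (Bool; true; false; if_then_else_; _∧_; _∨_; _xor_)
open import Data.Rational using (ℚ; 0ℚ; 1ℚ; _+_; _*_)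
open import Data.Product using (Σ; ∃; _×_; _,_)
open import Data.Sum using (_⊎_)
open import Relation.Nullary using (¬_)
open import Relation.Nullary.Decidable using (⌊_⌋)
open import Relation.Binary.PropositionalEquality using (_≡_; _≢_)
open import Function.Definitions using (Injective)

Graph : ℕ → Set
Graph n = Fin n → Fin n → Bool

IsSimple : {n : ℕ} → Graph n → Set
IsSimple {n} G = (∀ x y → G x y ≡ G y x) × (∀ x → G x x ≡ false)

Reduced : {n : ℕ} → Graph n → Set
Reduced {n} G = ∀ x y → x ≢ y → Σ (Fin n) (λ z → G x z ≢ G y z)

Matrix : ℕ → Set
Matrix n = Fin n → Fin n → ℚ

-- Adjacency matrix (over ℚ; the rank of an integer matrix is the same over ℚ and ℝ).
adjMatrix : {n : ℕ} → Graph n → Matrix n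
adjMatrix G x y = if G x y then 1ℚ else 0ℚ

sumFin : (k : ℕ) → (Fin k → ℚ) → ℚ
sumFin zero f = 0ℚ
sumFin (suc k) f = f zero + sumFin k (λ i → f (suc i))

RowsIndependent : {n k : ℕ} → Matrix n → (Fin k → Fin n) → Set
RowsIndependent {n} {k} A σ =
  (c : Fin k → ℚ) → (∀ j → sumFin k (λ i → c i * A (σ i) j) ≡ 0ℚ) → ∀ i → c i ≡ 0ℚ

HasRank : {n : ℕ} → Matrix n → ℕ → Set
HasRank {n} A r =
  (Σ (Fin r → Fin n) λ σ → Injective _≡_ _≡_ σ × RowsIndependent A σ)
  × ((σ : Fin (suc r) → Fin n) → Injective _≡_ _≡_ σ → ¬ RowsIndependent A σ)

_⊗_ : {n : ℕ} → Matrix n → Matrix n → Matrix n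
_⊗_ {n} A B i j = sumFin n (λ k → A i k * B k j)

idMatrix : {n : ℕ} → Matrix n
idMatrix i j = if ⌊ i ≟ j ⌋ then 1ℚ else 0ℚ

_≋_ : {n : ℕ} → Matrix n → Matrix n → Set
M ≋ N = ∀ i j → M i j ≡ N i j

Nonsingular : {n : ℕ} → Graph n → Set
Nonsingular {n} G = Σ (Matrix n) λ B →
  ((adjMatrix G ⊗ B) ≋ idMatrix) × ((B ⊗ adjMatrix G) ≋ idMatrix)

induced : {m n : ℕ} → Graph n → (Fin m → Fin n) → Graph m
induced G ι i j = G (ι i) (ι j)

toggle : {n : ℕ} → Graph n → Fin n → Fin n → Graph n
toggle G u v x y =
  G x y xor ((⌊ x ≟ u ⌋ ∧ ⌊ y ≟ v ⌋) ∨ (⌊ x ≟ v ⌋ ∧ ⌊ y ≟ u ⌋))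

module Submission where

-- Write A, T for the adjacency matrices of G and of G̃ = G with uv toggled, and H for
-- the submatrix of A on the rows and columns ι.  The proof is linear algebra over ℚ:
--   * an invertible m × m matrix has m independent rows, hence rank m, so r = m;
--   * as A has rank m, adding row u (or v) to the independent rows ι gives a dependent
--     family, so rows u and v of A lie in the span of the rows ι;
--   * (symmetric perturbation) T differs from A exactly in the entries (u,v), (v,u);
--     writing a relation among the rows u, v, ι of T over the rows ι of A, its part on
--     the columns ι is a relation of H, hence trivial, and the columns v and u then
--     kill the coefficients of u and v;
--   * G̃ has only m + 2 vertices, so no m + 3 rows are independent.

open import Defs
open import Data.Nat as ℕ using (ℕ; zero; suc; _≤_; _∸_)
import Data.Nat.Properties as ℕP
open import Data.Fin using (Fin; zero; suc; _≟_; _↑ʳ_)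
open import Data.Bool using (true; false; not; _∧_; _∨_; _xor_; if_then_else_)
open import Data.Bool.Properties using (xor-identityʳ; xor-comm; true-xor; not-¬)
import Data.Fin.Properties as FinP
open import Data.Vec.Functional using (_∷_)
open import Data.Rational using (ℚ; 0ℚ; 1ℚ; _+_; _*_; _-_; -_; 1/_)
open import Data.Rational.Base using (≢-nonZero)
import Data.Rational.Properties as ℚP
open import Algebra.Bundles using (CommutativeRing)
open import Data.Rational.Solver using (module +-*-Solver)
open import Data.Sum using (_⊎_; inj₁; inj₂)
open import Data.Product using (Σ; _×_; _,_; proj₁; proj₂)
open import Data.Empty using (⊥)
open import Function using (_∘_; id)
open import Function.Definitions using (Injective)
open import Relation.Binary.PropositionalEquality
open import Relation.Nullary using (¬_; yes; no; contradiction)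
open import Relation.Nullary.Negation using (¬¬-map)
open import Relation.Nullary.Decidable using (Dec; does; _×-dec_; _⊎-dec_; dec-true; dec-false; isYes≗does; decidable-stable)

open import Algebra.Properties.Group (CommutativeRing.+-group ℚP.+-*-commutativeRing)
  using (inverseˡ-unique; x∙y⁻¹≈ε⇒x≈y)
open import Algebra.Properties.Semiring.Sum (CommutativeRing.semiring ℚP.+-*-commutativeRing)
  using (sum; sum-cong-≗; ∑-distrib-+; ∑-comm; *-distribˡ-sum; *-distribʳ-sum)

private
  variable
    k m n r : ℕ

sumFin≡sum : ∀ k (f : Fin k → ℚ) → sumFin k f ≡ sum f
sumFin≡sum zero    f = refl
sumFin≡sum (suc k) f = cong (f zero +_) (sumFin≡sum k (f ∘ suc))

via-sum : ∀ {f g : Fin k → ℚ} → sum f ≡ sum g → sumFin k f ≡ sumFin k g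
via-sum {k} {f} {g} eq = trans (sumFin≡sum k f) (trans eq (sym (sumFin≡sum k g)))

sumFin-cong : ∀ k {f g : Fin k → ℚ} → (∀ i → f i ≡ g i) → sumFin k f ≡ sumFin k g
sumFin-cong k f≗g = via-sum {k} (sum-cong-≗ f≗g)

sumFin-zero : ∀ k {f : Fin k → ℚ} → (∀ i → f i ≡ 0ℚ) → sumFin k f ≡ 0ℚ
sumFin-zero zero    f≡0 = refl
sumFin-zero (suc k) f≡0 = trans (cong₂ _+_ (f≡0 zero) (sumFin-zero k (f≡0 ∘ suc))) (ℚP.+-identityˡ 0ℚ)

rowCombo : Matrix n → (Fin k → Fin n) → (Fin k → ℚ) → Fin n → ℚ
rowCombo {k = k} M τ c j = sumFin k (λ i → c i * M (τ i) j)

rowCombo-+ : (M : Matrix n) (τ : Fin k → Fin n) (c d : Fin k → ℚ) (j : Fin n) →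
  rowCombo M τ (λ i → c i + d i) j ≡ rowCombo M τ c j + rowCombo M τ d j
rowCombo-+ {k = k} M τ c d j = begin
  rowCombo M τ (λ i → c i + d i) j
    ≡⟨ sumFin-cong k (λ i → ℚP.*-distribʳ-+ (M (τ i) j) (c i) (d i)) ⟩
  sumFin k (λ i → c i * M (τ i) j + d i * M (τ i) j)
    ≡⟨ sumFin≡sum k _ ⟩
  sum (λ i → c i * M (τ i) j + d i * M (τ i) j)
    ≡⟨ ∑-distrib-+ (λ i → c i * M (τ i) j) (λ i → d i * M (τ i) j) ⟩
  sum (λ i → c i * M (τ i) j) + sum (λ i → d i * M (τ i) j)
    ≡⟨ sym (cong₂ _+_ (sumFin≡sum k _) (sumFin≡sum k _)) ⟩
  rowCombo M τ c j + rowCombo M τ d j ∎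
  where open ≡-Reasoning

rowCombo-scale : (M : Matrix n) (τ : Fin k → Fin n) (α : ℚ) (c : Fin k → ℚ) (j : Fin n) →
  rowCombo M τ (λ i → α * c i) j ≡ α * rowCombo M τ c j
rowCombo-scale {k = k} M τ α c j = begin
  rowCombo M τ (λ i → α * c i) j
    ≡⟨ sumFin-cong k (λ i → ℚP.*-assoc α (c i) (M (τ i) j)) ⟩
  sumFin k (λ i → α * (c i * M (τ i) j))
    ≡⟨ sumFin≡sum k _ ⟩
  sum (λ i → α * (c i * M (τ i) j))
    ≡⟨ sym (*-distribˡ-sum α (λ i → c i * M (τ i) j)) ⟩
  α * sum (λ i → c i * M (τ i) j)
    ≡⟨ cong (α *_) (sym (sumFin≡sum k _)) ⟩
  α * rowCombo M τ c j ∎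
  where open ≡-Reasoning

rowCombo-zero : (M : Matrix n) (τ : Fin k → Fin n) (c : Fin k → ℚ) → (∀ i → c i ≡ 0ℚ) →
  ∀ j → rowCombo M τ c j ≡ 0ℚ
rowCombo-zero {k = k} M τ c c≡0 j = sumFin-zero k (λ i → trans (cong (_* M (τ i) j) (c≡0 i)) (ℚP.*-zeroˡ (M (τ i) j)))

rowCombo-idMatrix : ∀ n (c : Fin n → ℚ) (l : Fin n) → rowCombo idMatrix id c l ≡ c l
rowCombo-idMatrix (suc n) c zero = begin
  c zero * 1ℚ + sumFin n (λ i → c (suc i) * 0ℚ)
    ≡⟨ cong₂ _+_ (ℚP.*-identityʳ (c zero)) (sumFin-zero n (λ i → ℚP.*-zeroʳ (c (suc i)))) ⟩
  c zero + 0ℚ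
    ≡⟨ ℚP.+-identityʳ (c zero) ⟩
  c zero ∎
  where open ≡-Reasoning
rowCombo-idMatrix (suc n) c (suc l) = begin
  c zero * 0ℚ + sumFin n (λ i → c (suc i) * idMatrix (suc i) (suc l))
    ≡⟨ cong₂ _+_ (ℚP.*-zeroʳ (c zero)) (sumFin-cong n (λ i → cong (c (suc i) *_) (idMatrix-suc i l))) ⟩
  0ℚ + rowCombo idMatrix id (c ∘ suc) l
    ≡⟨ ℚP.+-identityˡ _ ⟩
  rowCombo idMatrix id (c ∘ suc) l
    ≡⟨ rowCombo-idMatrix n (c ∘ suc) l ⟩
  c (suc l) ∎
  where
  open ≡-Reasoning
  idMatrix-suc : ∀ {n} (i l : Fin n) → idMatrix {suc n} (suc i) (suc l) ≡ idMatrix i l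
  idMatrix-suc i l with i ≟ l
  ... | yes _ = refl
  ... | no  _ = refl

rowCombo-⊗ : (M B : Matrix n) (c : Fin n → ℚ) (l : Fin n) →
  rowCombo (M ⊗ B) id c l ≡ sumFin n (λ k → rowCombo M id c k * B k l)
rowCombo-⊗ {n} M B c l = begin
  sumFin n (λ i → c i * sumFin n (λ k → M i k * B k l))
    ≡⟨ sumFin-cong n (λ i → trans (cong (c i *_) (sumFin≡sum n _)) (*-distribˡ-sum (c i) (λ k → M i k * B k l))) ⟩
  sumFin n (λ i → sum (λ k → c i * (M i k * B k l)))
    ≡⟨ via-sum {n} (∑-comm (λ i k → c i * (M i k * B k l))) ⟩
  sumFin n (λ k → sum (λ i → c i * (M i k * B k l)))
    ≡⟨ sumFin-cong n pull-out-B ⟩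
  sumFin n (λ k → rowCombo M id c k * B k l) ∎
  where
  open ≡-Reasoning
  pull-out-B : ∀ k → sum (λ i → c i * (M i k * B k l)) ≡ rowCombo M id c k * B k l
  pull-out-B k = begin
    sum (λ i → c i * (M i k * B k l))
      ≡⟨ sum-cong-≗ (λ i → sym (ℚP.*-assoc (c i) (M i k) (B k l))) ⟩
    sum (λ i → c i * M i k * B k l)
      ≡⟨ sym (*-distribʳ-sum (B k l) (λ i → c i * M i k)) ⟩
    sum (λ i → c i * M i k) * B k l
      ≡⟨ cong (_* B k l) (sym (sumFin≡sum n _)) ⟩
    rowCombo M id c k * B k l ∎

invertible⇒independent : (M B : Matrix n) → (M ⊗ B) ≋ idMatrix → RowsIndependent M id
invertible⇒independent {n} M B M⊗B≋I c cM≡0 l = begin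
  c l                                          ≡⟨ sym (rowCombo-idMatrix n c l) ⟩
  rowCombo idMatrix id c l                     ≡⟨ sumFin-cong n (λ i → cong (c i *_) (sym (M⊗B≋I i l))) ⟩
  rowCombo (M ⊗ B) id c l                      ≡⟨ rowCombo-⊗ M B c l ⟩
  sumFin n (λ k → rowCombo M id c k * B k l)   ≡⟨ sumFin-zero n (λ k → trans (cong (_* B k l) (cM≡0 k)) (ℚP.*-zeroˡ (B k l))) ⟩
  0ℚ ∎
  where open ≡-Reasoning

restriction-independent : (M : Matrix n) (τ κ : Fin m → Fin n) →
  RowsIndependent {m} (λ i k → M (τ i) (κ k)) id → RowsIndependent M τ
restriction-independent M τ κ ind c c≡0 = ind c (λ k → c≡0 (κ k))

drop-head-independent : (M : Matrix n) (τ : Fin (suc k) → Fin n) →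
  RowsIndependent M τ → RowsIndependent M (τ ∘ suc)
drop-head-independent M τ ind c c≡0 i = ind (0ℚ ∷ c) padded≡0 (suc i)
  where
  padded≡0 : ∀ j → 0ℚ * M (τ zero) j + rowCombo M (τ ∘ suc) c j ≡ 0ℚ
  padded≡0 j = trans (cong₂ _+_ (ℚP.*-zeroˡ (M (τ zero) j)) (c≡0 j)) (ℚP.+-identityˡ 0ℚ)

drop-independent : ∀ d (M : Matrix n) (τ : Fin (d ℕ.+ k) → Fin n) →
  RowsIndependent M τ → RowsIndependent M (τ ∘ (d ↑ʳ_))
drop-independent zero    M τ ind = ind
drop-independent (suc d) M τ ind = drop-independent d M (τ ∘ suc) (drop-head-independent M τ ind)

independent⇒≤rank : (M : Matrix n) → HasRank M r → (τ : Fin k → Fin n) → Injective _≡_ _≡_ τ →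
  RowsIndependent M τ → k ≤ r
independent⇒≤rank {r = r} {k = k} M (_ , maximal) τ inj ind = ℕP.≮⇒≥ (λ r<k → excess (k ∸ suc r) (ℕP.m∸n+n≡m r<k))
  where
  excess : ∀ d → d ℕ.+ suc r ≡ k → ⊥
  excess d refl = maximal (τ ∘ (d ↑ʳ_)) (λ eq → FinP.↑ʳ-injective d _ _ (inj eq)) (drop-independent d M τ ind)

invertible-rank : (M B : Matrix n) → (M ⊗ B) ≋ idMatrix → HasRank M r → r ≡ n
invertible-rank M B M⊗B≋I rank@((τ , inj , _) , _) =
  ℕP.≤-antisym (FinP.injective⇒≤ inj) (independent⇒≤rank M rank id id (invertible⇒independent M B M⊗B≋I))

Dependence : Matrix n → (Fin k → Fin n) → Set
Dependence {k = k} M τ =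
  Σ (Fin k → ℚ) λ c → (∀ j → rowCombo M τ c j ≡ 0ℚ) × Σ (Fin k) λ i → c i ≢ 0ℚ

-- Rows that are not independent satisfy a nontrivial relation, up to double negation
-- (equality on ℚ is decidable, so each coefficient is either 0 or not).
dependent⇒¬¬dependence : (M : Matrix n) (τ : Fin k → Fin n) →
  ¬ RowsIndependent M τ → ¬ ¬ Dependence M τ
dependent⇒¬¬dependence M τ dependent no-relation = dependent λ c c≡0 i →
  decidable-stable (c i ℚP.≟ 0ℚ) (λ cᵢ≢0 → no-relation (c , c≡0 , i , cᵢ≢0))

InSpan : Matrix n → (Fin k → Fin n) → Fin n → Set
InSpan {k = k} M τ x = Σ (Fin k → ℚ) λ a → ∀ j → M x j ≡ rowCombo M τ a j

relation-involves-head : (M : Matrix n) (x : Fin n) (τ : Fin k → Fin n) → RowsIndependent M τ →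
  (c : Fin (suc k) → ℚ) → (∀ j → rowCombo M (x ∷ τ) c j ≡ 0ℚ) →
  (i : Fin (suc k)) → c i ≢ 0ℚ → c zero ≢ 0ℚ
relation-involves-head M x τ ind c c≡0 i cᵢ≢0 c₀≡0 = cᵢ≢0 (all-zero i)
  where
  tail≡0 : ∀ j → rowCombo M τ (c ∘ suc) j ≡ 0ℚ
  tail≡0 j = begin
    rowCombo M τ (c ∘ suc) j                       ≡⟨ sym (ℚP.+-identityˡ _) ⟩
    0ℚ + rowCombo M τ (c ∘ suc) j                  ≡⟨ cong (_+ rowCombo M τ (c ∘ suc) j) (sym (ℚP.*-zeroˡ (M x j))) ⟩
    0ℚ * M x j + rowCombo M τ (c ∘ suc) j          ≡⟨ cong (λ c₀ → c₀ * M x j + rowCombo M τ (c ∘ suc) j) (sym c₀≡0) ⟩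
    c zero * M x j + rowCombo M τ (c ∘ suc) j      ≡⟨ c≡0 j ⟩
    0ℚ ∎
    where open ≡-Reasoning
  all-zero : ∀ i → c i ≡ 0ℚ
  all-zero zero    = c₀≡0
  all-zero (suc i) = ind (c ∘ suc) tail≡0 i

relation⇒InSpan : (M : Matrix n) (x : Fin n) (τ : Fin k → Fin n) (c : Fin (suc k) → ℚ) →
  (∀ j → rowCombo M (x ∷ τ) c j ≡ 0ℚ) → c zero ≢ 0ℚ → InSpan M τ x
relation⇒InSpan M x τ c c≡0 c₀≢0 = (λ i → - (1/ c₀) * c (suc i)) , solved-for-x
  where
  c₀ = c zero
  instance _ = ≢-nonZero c₀≢0
  solved-for-x : ∀ j → M x j ≡ rowCombo M τ (λ i → - (1/ c₀) * c (suc i)) j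
  solved-for-x j = begin
    M x j                           ≡⟨ sym (ℚP.*-identityˡ (M x j)) ⟩
    1ℚ * M x j                      ≡⟨ cong (_* M x j) (sym (ℚP.*-inverseˡ c₀)) ⟩
    1/ c₀ * c₀ * M x j              ≡⟨ ℚP.*-assoc (1/ c₀) c₀ (M x j) ⟩
    1/ c₀ * (c₀ * M x j)            ≡⟨ cong (1/ c₀ *_) (inverseˡ-unique (c₀ * M x j) rest (c≡0 j)) ⟩
    1/ c₀ * - rest                  ≡⟨ sym (ℚP.neg-distribʳ-* (1/ c₀) rest) ⟩
    - (1/ c₀ * rest)                ≡⟨ ℚP.neg-distribˡ-* (1/ c₀) rest ⟩
    - (1/ c₀) * rest                ≡⟨ sym (rowCombo-scale M τ (- (1/ c₀)) (c ∘ suc) j) ⟩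
    rowCombo M τ (λ i → - (1/ c₀) * c (suc i)) j ∎
    where
    open ≡-Reasoning
    rest = rowCombo M τ (c ∘ suc) j

dependent⇒¬¬InSpan : (M : Matrix n) (x : Fin n) (τ : Fin k → Fin n) → RowsIndependent M τ →
  ¬ RowsIndependent M (x ∷ τ) → ¬ ¬ InSpan M τ x
dependent⇒¬¬InSpan M x τ ind dependent = ¬¬-map
  (λ (c , c≡0 , i , cᵢ≢0) → relation⇒InSpan M x τ c c≡0 (relation-involves-head M x τ ind c c≡0 i cᵢ≢0))
  (dependent⇒¬¬dependence M (x ∷ τ) dependent)

*-cancel-nonzero : ∀ a b → a * b ≡ 0ℚ → b ≢ 0ℚ → a ≡ 0ℚ
*-cancel-nonzero a b ab≡0 b≢0 = begin
  a                  ≡⟨ sym (ℚP.*-identityʳ a) ⟩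
  a * 1ℚ             ≡⟨ cong (a *_) (sym (ℚP.*-inverseʳ b)) ⟩
  a * (b * 1/ b)     ≡⟨ sym (ℚP.*-assoc a b (1/ b)) ⟩
  a * b * 1/ b       ≡⟨ cong (_* 1/ b) ab≡0 ⟩
  0ℚ * 1/ b          ≡⟨ ℚP.*-zeroˡ (1/ b) ⟩
  0ℚ ∎
  where
  open ≡-Reasoning
  instance _ = ≢-nonZero b≢0

Toggled : Fin n → Fin n → Fin n → Fin n → Set
Toggled u v x y = (x ≡ u × y ≡ v) ⊎ (x ≡ v × y ≡ u)

module SymmetricPerturbation {m n : ℕ} (A T : Matrix n) (u v : Fin n) (u≢v : u ≢ v)
  (agree : ∀ x y → ¬ Toggled u v x y → T x y ≡ A x y)
  (differ-uv : T u v ≢ A u v) (differ-vu : T v u ≢ A v u)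
  (ι : Fin m → Fin n) (ι≢u : ∀ i → ι i ≢ u) (ι≢v : ∀ i → ι i ≢ v)
  (core-independent : RowsIndependent {m} (λ i k → A (ι i) (ι k)) id)
  where

  open +-*-Solver

  Δ : Matrix n
  Δ x y = T x y - A x y

  Δ-vanishes : ∀ x y → ¬ Toggled u v x y → Δ x y ≡ 0ℚ
  Δ-vanishes x y untoggled = trans (cong (_- A x y) (agree x y untoggled)) (ℚP.+-inverseʳ (A x y))

  Δ-nonzero : ∀ {x y} → T x y ≢ A x y → Δ x y ≢ 0ℚ
  Δ-nonzero T≢A Δ≡0 = T≢A (x∙y⁻¹≈ε⇒x≈y _ _ Δ≡0)

  row-ι-untoggled : ∀ i y → ¬ Toggled u v (ι i) y
  row-ι-untoggled i y (inj₁ (ιi≡u , _)) = ι≢u i ιi≡u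
  row-ι-untoggled i y (inj₂ (ιi≡v , _)) = ι≢v i ιi≡v

  u-ι-untoggled : ∀ k → ¬ Toggled u v u (ι k)
  u-ι-untoggled k (inj₁ (_ , ιk≡v)) = ι≢v k ιk≡v
  u-ι-untoggled k (inj₂ (u≡v , _))  = u≢v u≡v

  v-ι-untoggled : ∀ k → ¬ Toggled u v v (ι k)
  v-ι-untoggled k (inj₁ (v≡u , _))  = u≢v (sym v≡u)
  v-ι-untoggled k (inj₂ (_ , ιk≡u)) = ι≢u k ιk≡u

  diagonal-untoggled : ∀ x → ¬ Toggled u v x x
  diagonal-untoggled x (inj₁ (x≡u , x≡v)) = u≢v (trans (sym x≡u) x≡v)
  diagonal-untoggled x (inj₂ (x≡v , x≡u)) = u≢v (trans (sym x≡u) x≡v)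

  perturbed-independent : InSpan A ι u → InSpan A ι v → RowsIndependent T (u ∷ v ∷ ι)
  perturbed-independent (a , u≡a) (b , v≡b) c c≡0 = all-zero
    where
    cu cv : ℚ
    cu = c zero
    cv = c (suc zero)
    c′ : Fin m → ℚ
    c′ i = c (suc (suc i))

    -- Coefficients of the combination rewritten over the basis rows ι of A.
    g : Fin m → ℚ
    g i = c′ i + cu * a i + cv * b i

    g-combo : ∀ j → rowCombo A ι g j ≡ rowCombo T ι c′ j + cu * A u j + cv * A v j
    g-combo j = begin
      rowCombo A ι g j
        ≡⟨ rowCombo-+ A ι (λ i → c′ i + cu * a i) (λ i → cv * b i) j ⟩
      rowCombo A ι (λ i → c′ i + cu * a i) j + rowCombo A ι (λ i → cv * b i) j
        ≡⟨ cong₂ _+_ (rowCombo-+ A ι c′ (λ i → cu * a i) j) (rowCombo-scale A ι cv b j) ⟩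
      rowCombo A ι c′ j + rowCombo A ι (λ i → cu * a i) j + cv * rowCombo A ι b j
        ≡⟨ cong (λ s → rowCombo A ι c′ j + s + cv * rowCombo A ι b j) (rowCombo-scale A ι cu a j) ⟩
      rowCombo A ι c′ j + cu * rowCombo A ι a j + cv * rowCombo A ι b j
        ≡⟨ cong₃ (λ p q r → p + cu * q + cv * r) (sym T≡A-on-ι) (sym (u≡a j)) (sym (v≡b j)) ⟩
      rowCombo T ι c′ j + cu * A u j + cv * A v j ∎
      where
      open ≡-Reasoning
      T≡A-on-ι : rowCombo T ι c′ j ≡ rowCombo A ι c′ j
      T≡A-on-ι = sumFin-cong m (λ i → cong (c′ i *_) (agree (ι i) j (row-ι-untoggled i j)))
      cong₃ : ∀ (f : ℚ → ℚ → ℚ → ℚ) {p p′ q q′ r r′} → p ≡ p′ → q ≡ q′ → r ≡ r′ → f p q r ≡ f p′ q′ r′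
      cong₃ f refl refl refl = refl

    residual : ∀ j → cu * Δ u j + cv * Δ v j + rowCombo A ι g j ≡ 0ℚ
    residual j = begin
      cu * Δ u j + cv * Δ v j + rowCombo A ι g j
        ≡⟨ cong (cu * Δ u j + cv * Δ v j +_) (g-combo j) ⟩
      cu * Δ u j + cv * Δ v j + (rowCombo T ι c′ j + cu * A u j + cv * A v j)
        ≡⟨ solve 7 (λ cu cv Tu Tv Au Av P →
             cu :* (Tu :- Au) :+ cv :* (Tv :- Av) :+ (P :+ cu :* Au :+ cv :* Av)
             := cu :* Tu :+ (cv :* Tv :+ P))
             refl cu cv (T u j) (T v j) (A u j) (A v j) (rowCombo T ι c′ j) ⟩
      rowCombo T (u ∷ v ∷ ι) c j
        ≡⟨ c≡0 j ⟩
      0ℚ ∎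
      where open ≡-Reasoning

    -- On the columns ι the perturbation is invisible, so g is a relation of the core.
    g≡0 : ∀ i → g i ≡ 0ℚ
    g≡0 = core-independent g λ k → begin
      rowCombo A ι g (ι k)
        ≡⟨ solve 3 (λ cu cv r → r := cu :* con 0ℚ :+ cv :* con 0ℚ :+ r) refl cu cv (rowCombo A ι g (ι k)) ⟩
      cu * 0ℚ + cv * 0ℚ + rowCombo A ι g (ι k)
        ≡⟨ cong₂ (λ p q → cu * p + cv * q + rowCombo A ι g (ι k))
             (sym (Δ-vanishes u (ι k) (u-ι-untoggled k))) (sym (Δ-vanishes v (ι k) (v-ι-untoggled k))) ⟩
      cu * Δ u (ι k) + cv * Δ v (ι k) + rowCombo A ι g (ι k)
        ≡⟨ residual (ι k) ⟩
      0ℚ ∎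
      where open ≡-Reasoning

    perturbation≡0 : ∀ j → cu * Δ u j + cv * Δ v j ≡ 0ℚ
    perturbation≡0 j = begin
      cu * Δ u j + cv * Δ v j                         ≡⟨ sym (ℚP.+-identityʳ _) ⟩
      cu * Δ u j + cv * Δ v j + 0ℚ                    ≡⟨ cong (cu * Δ u j + cv * Δ v j +_) (sym (rowCombo-zero A ι g g≡0 j)) ⟩
      cu * Δ u j + cv * Δ v j + rowCombo A ι g j      ≡⟨ residual j ⟩
      0ℚ ∎
      where open ≡-Reasoning

    -- Column v sees only the change in row u, column u only the change in row v.
    cu≡0 : cu ≡ 0ℚ
    cu≡0 = *-cancel-nonzero cu (Δ u v) cuΔ≡0 (Δ-nonzero differ-uv)
      where
      cuΔ≡0 : cu * Δ u v ≡ 0ℚ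
      cuΔ≡0 = trans (sym (trans (cong (λ d → cu * Δ u v + cv * d) (Δ-vanishes v v (diagonal-untoggled v)))
                                (trans (cong (cu * Δ u v +_) (ℚP.*-zeroʳ cv)) (ℚP.+-identityʳ _))))
                    (perturbation≡0 v)

    cv≡0 : cv ≡ 0ℚ
    cv≡0 = *-cancel-nonzero cv (Δ v u) cvΔ≡0 (Δ-nonzero differ-vu)
      where
      cvΔ≡0 : cv * Δ v u ≡ 0ℚ
      cvΔ≡0 = trans (sym (trans (cong (λ d → cu * d + cv * Δ v u) (Δ-vanishes u u (diagonal-untoggled u)))
                                (trans (cong (_+ cv * Δ v u) (ℚP.*-zeroʳ cu)) (ℚP.+-identityˡ _))))
                    (perturbation≡0 u)

    all-zero : ∀ i → c i ≡ 0ℚ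
    all-zero zero          = cu≡0
    all-zero (suc zero)    = cv≡0
    all-zero (suc (suc i)) = begin
      c′ i                               ≡⟨ solve 3 (λ c a b → c := c :+ con 0ℚ :* a :+ con 0ℚ :* b) refl (c′ i) (a i) (b i) ⟩
      c′ i + 0ℚ * a i + 0ℚ * b i         ≡⟨ cong₂ (λ p q → c′ i + p * a i + q * b i) (sym cu≡0) (sym cv≡0) ⟩
      g i                                ≡⟨ g≡0 i ⟩
      0ℚ ∎
      where open ≡-Reasoning

toggled? : (u v x y : Fin n) → Dec (Toggled u v x y)
toggled? u v x y = (x ≟ u ×-dec y ≟ v) ⊎-dec (x ≟ v ×-dec y ≟ u)

toggle-as-xor : (G : Graph n) (u v x y : Fin n) → toggle G u v x y ≡ G x y xor does (toggled? u v x y)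
toggle-as-xor G u v x y = cong (G x y xor_)
  (cong₂ _∨_ (cong₂ _∧_ (isYes≗does (x ≟ u)) (isYes≗does (y ≟ v)))
             (cong₂ _∧_ (isYes≗does (x ≟ v)) (isYes≗does (y ≟ u))))

toggle-agrees : (G : Graph n) (u v x y : Fin n) → ¬ Toggled u v x y → toggle G u v x y ≡ G x y
toggle-agrees G u v x y untoggled = begin
  toggle G u v x y                         ≡⟨ toggle-as-xor G u v x y ⟩
  G x y xor does (toggled? u v x y)        ≡⟨ cong (G x y xor_) (dec-false (toggled? u v x y) untoggled) ⟩
  G x y xor false                          ≡⟨ xor-identityʳ (G x y) ⟩
  G x y ∎
  where open ≡-Reasoning

toggle-flips : (G : Graph n) (u v x y : Fin n) → Toggled u v x y → toggle G u v x y ≡ not (G x y)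
toggle-flips G u v x y toggled = begin
  toggle G u v x y                         ≡⟨ toggle-as-xor G u v x y ⟩
  G x y xor does (toggled? u v x y)        ≡⟨ cong (G x y xor_) (dec-true (toggled? u v x y) toggled) ⟩
  G x y xor true                           ≡⟨ xor-comm (G x y) true ⟩
  true xor G x y                           ≡⟨ true-xor (G x y) ⟩
  not (G x y) ∎
  where open ≡-Reasoning

adjacency-entry-injective : ∀ b c → (if b then 1ℚ else 0ℚ) ≡ (if c then 1ℚ else 0ℚ) → b ≡ c
adjacency-entry-injective true  true  _ = refl
adjacency-entry-injective false false _ = refl
adjacency-entry-injective true  false ()
adjacency-entry-injective false true  ()

toggle-adjacency-agrees : (G : Graph n) (u v x y : Fin n) → ¬ Toggled u v x y →
  adjMatrix (toggle G u v) x y ≡ adjMatrix G x y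
toggle-adjacency-agrees G u v x y untoggled =
  cong (λ b → if b then 1ℚ else 0ℚ) (toggle-agrees G u v x y untoggled)

toggle-adjacency-differs : (G : Graph n) (u v x y : Fin n) → Toggled u v x y →
  adjMatrix (toggle G u v) x y ≢ adjMatrix G x y
toggle-adjacency-differs G u v x y toggled same =
  not-¬ refl (trans (sym (adjacency-entry-injective _ _ same)) (toggle-flips G u v x y toggled))

∷-injective : (x : Fin n) (τ : Fin k → Fin n) → Injective _≡_ _≡_ τ → (∀ i → τ i ≢ x) →
  Injective _≡_ _≡_ (x ∷ τ)
∷-injective x τ inj τ≢x {zero}  {zero}  _    = refl
∷-injective x τ inj τ≢x {zero}  {suc j} x≡τj = contradiction (sym x≡τj) (τ≢x j)
∷-injective x τ inj τ≢x {suc i} {zero}  τi≡x = contradiction τi≡x (τ≢x i)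
∷-injective x τ inj τ≢x {suc i} {suc j} eq   = cong suc (inj eq)

covering⇒≥ : (σ : Fin k → Fin n) → (∀ x → Σ (Fin k) λ i → σ i ≡ x) → n ≤ k
covering⇒≥ σ cover = FinP.injective⇒≤ {f = proj₁ ∘ cover}
  λ {x} {y} eq → trans (sym (proj₂ (cover x))) (trans (cong σ eq) (proj₂ (cover y)))

two-plus-covering : (u v : Fin n) (ι : Fin m → Fin n) →
  (∀ x → x ≡ u ⊎ (x ≡ v ⊎ Σ (Fin m) (λ i → ι i ≡ x))) →
  ∀ x → Σ (Fin (suc (suc m))) λ i → (u ∷ v ∷ ι) i ≡ x
two-plus-covering u v ι cover x with cover x
... | inj₁ x≡u                 = zero , sym x≡u
... | inj₂ (inj₁ x≡v)          = suc zero , sym x≡v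
... | inj₂ (inj₂ (i , ιi≡x))   = suc (suc i) , ιi≡x

lemma2p7 : {m n : ℕ} (G : Graph n) → IsSimple G → Reduced G →
    (ι : Fin m → Fin n) → Injective _≡_ _≡_ ι →
    (u v : Fin n) → u ≢ v → (∀ i → ι i ≢ u) → (∀ i → ι i ≢ v) →
    (∀ x → x ≡ u ⊎ (x ≡ v ⊎ Σ (Fin m) (λ i → ι i ≡ x))) →
    Nonsingular (induced G ι) →
    (r : ℕ) → HasRank (adjMatrix (induced G ι)) r → HasRank (adjMatrix G) r →
    HasRank (adjMatrix (toggle G u v)) (r ℕ.+ 2)
lemma2p7 {m} G _ _ ι ι-inj u v u≢v ι≢u ι≢v cover (B , H⊗B≋I , _) r rank-H (_ , maximal-G)
  with refl ← invertible-rank (adjMatrix (induced G ι)) B H⊗B≋I rank-H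
  = subst (HasRank T) (ℕP.+-comm 2 m) ((σ , σ-injective , σ-independent) , no-more-rows)
  where
  A T : Matrix _
  A = adjMatrix G
  T = adjMatrix (toggle G u v)
  σ : Fin (suc (suc m)) → Fin _
  σ = u ∷ v ∷ ι
  σ-injective : Injective _≡_ _≡_ σ
  σ-injective = ∷-injective u (v ∷ ι) (∷-injective v ι ι-inj ι≢v)
    (λ { zero v≡u → u≢v (sym v≡u) ; (suc i) → ι≢u i })
  H-independent : RowsIndependent (adjMatrix (induced G ι)) id
  H-independent = invertible⇒independent (adjMatrix (induced G ι)) B H⊗B≋I
  in-span : ∀ x → (∀ i → ι i ≢ x) → ¬ ¬ InSpan A ι x
  in-span x ι≢x = dependent⇒¬¬InSpan A x ι (restriction-independent A ι ι H-independent)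
    (maximal-G (x ∷ ι) (∷-injective x ι ι-inj ι≢x))
  open SymmetricPerturbation A T u v u≢v (toggle-adjacency-agrees G u v)
    (toggle-adjacency-differs G u v u v (inj₁ (refl , refl)))
    (toggle-adjacency-differs G u v v u (inj₂ (refl , refl))) ι ι≢u ι≢v H-independent
  σ-independent : RowsIndependent T σ
  σ-independent c c≡0 i = decidable-stable (c i ℚP.≟ 0ℚ) λ cᵢ≢0 →
    in-span u ι≢u λ u-span → in-span v ι≢v λ v-span →
    cᵢ≢0 (perturbed-independent u-span v-span c c≡0 i)
  no-more-rows : (τ : Fin (suc (suc (suc m))) → Fin _) → Injective _≡_ _≡_ τ → ¬ RowsIndependent T τ
  no-more-rows τ τ-inj _ = ℕP.1+n≰n
    (ℕP.≤-trans (FinP.injective⇒≤ τ-inj) (covering⇒≥ σ (two-plus-covering u v ι cover)))
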